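{- Let $p$ be a prime, let $d\neq0$ be a rational number and let $x$ be a $p$-adic integer. (i) For every positive integer $n$, \[ \sum_{k=0}^{n-1}\left(x^2+x-(1+4d)k^2-(1-2d)k\right)\frac{d^{ -k}{x\choose k}{x+k\choose k}}{{2k\choose k}} =-2nd+n\sum_{k=0}^{n-1}\left(x^2+x+2d-(1+4d)k^2-(1+2d)k\right)\frac{d^{ -k}{x\choose k}{x+k\choose k}}{(k+1){2k\choose k}} \] \[ =(2n-1)\sum_{k=0}^{n-1}\left(x^2+x-(1+4d)k^2-(1+2d)k\right)\frac{d^{ -k}{x\choose k}{x+k\choose k}}{(2k+1){2k\choose k}}. \] (ii) For every positive odd integer $n$, \[ \sum_{k=0}^{\frac{n-1}{2}}\left(x^2+x-(1+4d)k^2-(1-2d)k\right)\frac{d^{ -k}{x\choose k}{x+k\choose k}}{{2k\choose k}} =-d(n+1)+\frac{n+1}{2}\sum_{k=0}^{\frac{n-1}{2}}\left(x^2+x+2d-(1+4d)k^2-(1+2d)k\right)\frac{d^{ -k}{x\choose k}{x+k\choose k}}{(k+1){2k\choose k}} \] \[ =n\sum_{k=0}^{\frac{n-1}{2}}\left(x^2+x-(1+4d)k^2-(1+2d)k\right)\frac{d^{ -k}{x\choose k}{x+k\choose k}}{(2k+1){2k\choose k}}. \]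
   Context: For $x\in\mathbb{Z}_p$ and $k\in\{0,1,2,\dots\}$, ${x\choose k}=\frac{x(x-1)\cdots(x-k+1)}{k!}$ is the generalized binomial coefficient. The identities are equalities in $\mathbb{Q}_p$. -}

module Defs where

open import Level using (Level; _⊔_)
open import Data.Nat as ℕ using (ℕ; zero; suc; _<_; _≤_; z≤n; s≤s)
import Data.Nat.Properties as ℕP
open import Data.Nat.Combinatorics using (_C_; nCk+nC[k+1]≡[n+1]C[k+1])
open import Data.Integer using (+_)
open import Data.Rational as ℚ using (ℚ; 0ℚ; 1ℚ)
import Data.Rational.Properties as ℚP
open import Algebra.Bundles using (CommutativeRing)
open import Algebra.Morphism.Structures using (IsRingHomomorphism)
open import Relation.Binary.PropositionalEquality using (_≡_; _≢_; subst; sym)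

-- A ℚ-algebra: a commutative ring R with a ring homomorphism ι : ℚ → R.
-- (Q_p, which contains Z_p, is such an algebra.)

record QAlgebra (c ℓ : Level) : Set (Level.suc (c ⊔ ℓ)) where
  field
    R     : CommutativeRing c ℓ
  open CommutativeRing R public
  field
    ι     : ℚ → Carrier
    ι-hom : IsRingHomomorphism ℚP.+-*-rawRing rawRing ι

ℕ→ℚ : ℕ → ℚ
ℕ→ℚ n = + n ℚ./ 1

_^ℚ_ : ℚ → ℕ → ℚ
q ^ℚ zero  = 1ℚ
q ^ℚ suc k = q ℚ.* (q ^ℚ k)

nCk>0 : ∀ n k → k ≤ n → 0 < n C k
nCk>0 n       zero    _         = ℕ.s≤s ℕ.z≤n
nCk>0 (suc n) (suc k) (s≤s k≤n) =
  subst (0 <_) (nCk+nC[k+1]≡[n+1]C[k+1] n k)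
        (ℕP.<-≤-trans (nCk>0 n k k≤n) (ℕP.m≤m+n (n C k) (n C suc k)))

centralBinom-nonZero : ∀ k → ℕ.NonZero ((2 ℕ.* k) C k)
centralBinom-nonZero k = ℕ.>-nonZero (nCk>0 (2 ℕ.* k) k (ℕP.m≤n*m k 2))

invCentralBinom : ℕ → ℚ
invCentralBinom k = + 1 ℚ./ ((2 ℕ.* k) C k)
  where instance _ = centralBinom-nonZero k

dPowNeg : (d : ℚ) → d ≢ 0ℚ → ℕ → ℚ
dPowNeg d d≢0 k = (ℚ.1/ d) ^ℚ k
  where instance _ = ℚ.≢-nonZero d≢0

module _ {c ℓ} (A : QAlgebra c ℓ) where
  open QAlgebra A

  Σ< : ℕ → (ℕ → Carrier) → Carrier
  Σ< zero    f = 0#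
  Σ< (suc n) f = Σ< n f + f n

  falling : Carrier → ℕ → Carrier
  falling x zero    = 1#
  falling x (suc k) = falling x k * (x - ι (ℕ→ℚ k))

  binom : Carrier → ℕ → Carrier
  binom x k = falling x k * ι (+ 1 ℚ./ (k ℕ.!))
    where instance _ = k ℕP.!≢0

  core : (d : ℚ) → d ≢ 0ℚ → Carrier → ℕ → Carrier
  core d d≢0 x k = ι (dPowNeg d d≢0 k) * binom x k * binom (x + ι (ℕ→ℚ k)) k

  polyA : ℚ → Carrier → ℕ → Carrier
  polyA d x k = x * x + x - ι ((1ℚ ℚ.+ ℕ→ℚ 4 ℚ.* d) ℚ.* ℕ→ℚ k ℚ.* ℕ→ℚ k)
                          - ι ((1ℚ ℚ.- ℕ→ℚ 2 ℚ.* d) ℚ.* ℕ→ℚ k)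

  polyB : ℚ → Carrier → ℕ → Carrier
  polyB d x k = x * x + x + ι (ℕ→ℚ 2 ℚ.* d)
                - ι ((1ℚ ℚ.+ ℕ→ℚ 4 ℚ.* d) ℚ.* ℕ→ℚ k ℚ.* ℕ→ℚ k)
                - ι ((1ℚ ℚ.+ ℕ→ℚ 2 ℚ.* d) ℚ.* ℕ→ℚ k)

  polyC : ℚ → Carrier → ℕ → Carrier
  polyC d x k = x * x + x - ι ((1ℚ ℚ.+ ℕ→ℚ 4 ℚ.* d) ℚ.* ℕ→ℚ k ℚ.* ℕ→ℚ k)
                          - ι ((1ℚ ℚ.+ ℕ→ℚ 2 ℚ.* d) ℚ.* ℕ→ℚ k)

  SumA : (d : ℚ) → d ≢ 0ℚ → Carrier → ℕ → Carrier
  SumA d d≢0 x N = Σ< N λ k →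
    polyA d x k * (core d d≢0 x k * ι (invCentralBinom k))

  SumB : (d : ℚ) → d ≢ 0ℚ → Carrier → ℕ → Carrier
  SumB d d≢0 x N = Σ< N λ k →
    polyB d x k * (core d d≢0 x k * ι (invCentralBinom k ℚ.* (+ 1 ℚ./ suc k)))

  SumC : (d : ℚ) → d ≢ 0ℚ → Carrier → ℕ → Carrier
  SumC d d≢0 x N = Σ< N λ k →
    polyC d x k * (core d d≢0 x k * ι (invCentralBinom k ℚ.* (+ 1 ℚ./ suc (2 ℕ.* k))))

{-# OPTIONS --safe #-}
module Submission where

-- Write a_k = d^{-k} C(x,k) C(x+k,k) / C(2k,k). The ratio of consecutive terms is
-- rational in k:  2d(k+1)(2k+1) a_{k+1} = (x-k)(x+k+1) a_k.  Since
-- x^2+x-(1+4d)k^2-(1-2d)k = (x-k)(x+k+1) - 2dk(2k-1), and similarly for the other two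
-- polynomials, every summand telescopes: the summands of the three sums are G(k+1) - G(k)
-- for G(k) = 2dk(2k-1) a_k, 2d(2k-1) a_k and 2dk a_k respectively. So the sums equal
-- 2dn(2n-1) a_n, 2d(2n-1) a_n + 2d and 2dn a_n, which gives (i); (ii) is (i) at (n+1)/2.

open import Defs
open import Level using (Level)
open import Function using (_∘_)
open import Data.Nat as ℕ using (ℕ; zero; suc; _≤_; _%_; _/_)
import Data.Nat.Properties as ℕP
open import Data.Nat.Combinatorics using (_C_; nCk+nC[k+1]≡[n+1]C[k+1]; nCk≡nC[n∸k]; nC1≡n)
open import Data.Nat.DivMod using (m≡m%n+[m/n]*n; m*n/n≡m)
import Data.Nat.Tactic.RingSolver as ℕ-Solver
open import Data.Nat.Primality using (Prime)
open import Data.Integer as ℤ using (+_; 1ℤ)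
import Data.Integer.Properties as ℤP
import Data.Integer.Tactic.RingSolver as ℤ-Solver
open import Data.Rational as ℚ using (ℚ; 0ℚ; 1ℚ; toℚᵘ)
import Data.Rational.Properties as ℚP
open import Data.Rational.Unnormalised as ℚᵘ using (mkℚᵘ; *≡*)
import Data.Rational.Unnormalised.Properties as ℚᵘP
open import Data.Product using (_×_; _,_; proj₁; proj₂)
open import Data.Maybe using (map)
open import Relation.Nullary.Decidable using (dec⇒maybe)
open import Algebra.Bundles using (CommutativeMonoid)
open import Algebra.Morphism.Structures using (module IsRingHomomorphism)
open import Algebra.Solver.Ring.AlmostCommutativeRing
  using (fromCommutativeRing; _-Raw-AlmostCommutative⟶_)
import Algebra.Properties.CommutativeSemigroup as CommutativeSemigroupProperties
open import Relation.Binary.Definitions using (WeaklyDecidable)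
open import Relation.Binary.PropositionalEquality as ≡ using (_≡_; _≢_)
import Relation.Binary.Reasoning.Setoid as SetoidReasoning

[k+1]*[n+1]C[k+1]≡[n+1]*nCk : ∀ n k → suc k ℕ.* (suc n C suc k) ≡ suc n ℕ.* (n C k)
[k+1]*[n+1]C[k+1]≡[n+1]*nCk zero    zero    = ≡.refl
[k+1]*[n+1]C[k+1]≡[n+1]*nCk zero    (suc k) = ℕP.*-zeroʳ (2 ℕ.+ k)
[k+1]*[n+1]C[k+1]≡[n+1]*nCk (suc n) zero    =
  ≡.trans (ℕP.+-identityʳ _) (≡.trans (nC1≡n (2 ℕ.+ n)) (≡.sym (ℕP.*-identityʳ (2 ℕ.+ n))))
[k+1]*[n+1]C[k+1]≡[n+1]*nCk (suc n) (suc k) = begin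
  (2 + k) * (suc (suc n) C suc (suc k))            ≡⟨ ≡.cong ((2 + k) *_) (pascal (suc n) (suc k)) ⟨
  (2 + k) * (a + b)                                ≡⟨ split k a b ⟩
  ((1 + k) * a + (2 + k) * b) + a                  ≡⟨ ≡.cong₂ (λ u v → (u + v) + a) (IH k) (IH (suc k)) ⟩
  ((1 + n) * (n C k) + (1 + n) * (n C suc k)) + a  ≡⟨ ≡.cong (_+ a) (ℕP.*-distribˡ-+ (1 + n) (n C k) (n C suc k)) ⟨
  (1 + n) * (n C k + n C suc k) + a                ≡⟨ ≡.cong (λ c → (1 + n) * c + a) (pascal n k) ⟩
  (1 + n) * a + a                                  ≡⟨ ℕP.+-comm ((1 + n) * a) a ⟩
  (2 + n) * a                                      ∎
  where
  open ≡.≡-Reasoning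
  open import Data.Nat.Base using (_+_; _*_)
  pascal = nCk+nC[k+1]≡[n+1]C[k+1]
  a = suc n C suc k
  b = suc n C suc (suc k)
  IH = [k+1]*[n+1]C[k+1]≡[n+1]*nCk n
  split : ∀ k a b → (2 + k) * (a + b) ≡ ((1 + k) * a + (2 + k) * b) + a
  split = ℕ-Solver.solve-∀

[k+1]*[2k+2]C[k+1]≡2[2k+1]*[2k]Ck : ∀ k →
  suc k ℕ.* ((2 ℕ.* suc k) C suc k) ≡ 2 ℕ.* suc (2 ℕ.* k) ℕ.* ((2 ℕ.* k) C k)
[k+1]*[2k+2]C[k+1]≡2[2k+1]*[2k]Ck k = begin
  suc k * ((2 * suc k) C suc k)        ≡⟨ ≡.cong (λ m → suc k * (m C suc k)) (ℕP.*-suc 2 k) ⟩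
  suc k * (suc (suc (2 * k)) C suc k)  ≡⟨ ≡.cong (suc k *_) (pascal (suc (2 * k)) k) ⟨
  suc k * (suc (2 * k) C k + c)        ≡⟨ ≡.cong (λ b → suc k * (b + c)) symmetric ⟩
  suc k * (c + c)                      ≡⟨ double (suc k) c ⟩
  2 * (suc k * c)                      ≡⟨ ≡.cong (2 *_) ([k+1]*[n+1]C[k+1]≡[n+1]*nCk (2 * k) k) ⟩
  2 * (suc (2 * k) * ((2 * k) C k))    ≡⟨ ℕP.*-assoc 2 (suc (2 * k)) _ ⟨
  2 * suc (2 * k) * ((2 * k) C k)      ∎
  where
  open ≡.≡-Reasoning
  open import Data.Nat.Base using (_+_; _*_)
  pascal = nCk+nC[k+1]≡[n+1]C[k+1]
  c = suc (2 * k) C suc k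
  split : ∀ k → suc (2 * k) ≡ k + suc k
  split = ℕ-Solver.solve-∀
  symmetric : suc (2 * k) C k ≡ c
  symmetric = ≡.trans (nCk≡nC[n∸k] (ℕP.m≤n⇒m≤1+n (ℕP.m≤n*m k 2)))
    (≡.cong (suc (2 * k) C_) (≡.trans (≡.cong (ℕ._∸ k) (split k)) (ℕP.m+n∸m≡n k (suc k))))
  double : ∀ m c → m * (c + c) ≡ 2 * (m * c)
  double = ℕ-Solver.solve-∀

odd⇒≡1+[n/2]*2 : ∀ n → n % 2 ≡ 1 → n ≡ suc (n / 2 ℕ.* 2)
odd⇒≡1+[n/2]*2 n odd = ≡.trans (m≡m%n+[m/n]*n n 2) (≡.cong (ℕ._+ n / 2 ℕ.* 2) odd)

-- ℕ→ℚ n unfolds to fromℚᵘ (mkℚᵘ (+ n) 0), so facts about ℕ→ℚ reduce to ℚᵘ.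
toℚᵘ-ℕ→ℚ : ∀ n → toℚᵘ (ℕ→ℚ n) ℚᵘ.≃ mkℚᵘ (+ n) 0
toℚᵘ-ℕ→ℚ n = ℚP.toℚᵘ-fromℚᵘ (mkℚᵘ (+ n) 0)

ℕ→ℚ-+ : ∀ m n → ℕ→ℚ (m ℕ.+ n) ≡ ℕ→ℚ m ℚ.+ ℕ→ℚ n
ℕ→ℚ-+ m n = ℚP.toℚᵘ-injective (begin
  toℚᵘ (ℕ→ℚ (m ℕ.+ n))               ≈⟨ toℚᵘ-ℕ→ℚ (m ℕ.+ n) ⟩
  mkℚᵘ (+ m ℤ.+ + n) 0               ≈⟨ *≡* (distrib (+ m) (+ n)) ⟩
  mkℚᵘ (+ m) 0 ℚᵘ.+ mkℚᵘ (+ n) 0      ≈⟨ ℚᵘP.+-cong (toℚᵘ-ℕ→ℚ m) (toℚᵘ-ℕ→ℚ n) ⟨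
  toℚᵘ (ℕ→ℚ m) ℚᵘ.+ toℚᵘ (ℕ→ℚ n)      ≈⟨ ℚP.toℚᵘ-homo-+ (ℕ→ℚ m) (ℕ→ℚ n) ⟨
  toℚᵘ (ℕ→ℚ m ℚ.+ ℕ→ℚ n)             ∎)
  where
  open ℚᵘP.≃-Reasoning
  distrib : ∀ i j → (i ℤ.+ j) ℤ.* 1ℤ ≡ (i ℤ.* 1ℤ ℤ.+ j ℤ.* 1ℤ) ℤ.* 1ℤ
  distrib = ℤ-Solver.solve-∀

ℕ→ℚ-* : ∀ m n → ℕ→ℚ (m ℕ.* n) ≡ ℕ→ℚ m ℚ.* ℕ→ℚ n
ℕ→ℚ-* m n = ℚP.toℚᵘ-injective (begin
  toℚᵘ (ℕ→ℚ (m ℕ.* n))               ≈⟨ toℚᵘ-ℕ→ℚ (m ℕ.* n) ⟩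
  mkℚᵘ (+ (m ℕ.* n)) 0               ≈⟨ *≡* (≡.cong (ℤ._* 1ℤ) (ℤP.pos-* m n)) ⟩
  mkℚᵘ (+ m) 0 ℚᵘ.* mkℚᵘ (+ n) 0      ≈⟨ ℚᵘP.*-cong (toℚᵘ-ℕ→ℚ m) (toℚᵘ-ℕ→ℚ n) ⟨
  toℚᵘ (ℕ→ℚ m) ℚᵘ.* toℚᵘ (ℕ→ℚ n)      ≈⟨ ℚP.toℚᵘ-homo-* (ℕ→ℚ m) (ℕ→ℚ n) ⟨
  toℚᵘ (ℕ→ℚ m ℚ.* ℕ→ℚ n)             ∎)
  where open ℚᵘP.≃-Reasoning

1/n*n≡1 : ∀ n .{{_ : ℕ.NonZero n}} → (+ 1 ℚ./ n) ℚ.* ℕ→ℚ n ≡ 1ℚ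
1/n*n≡1 n@(suc m) = ℚP.toℚᵘ-injective (begin
  toℚᵘ ((+ 1 ℚ./ n) ℚ.* ℕ→ℚ n)        ≈⟨ ℚP.toℚᵘ-homo-* (+ 1 ℚ./ n) (ℕ→ℚ n) ⟩
  toℚᵘ (+ 1 ℚ./ n) ℚᵘ.* toℚᵘ (ℕ→ℚ n)  ≈⟨ ℚᵘP.*-cong (ℚP.toℚᵘ-fromℚᵘ (mkℚᵘ (+ 1) m)) (toℚᵘ-ℕ→ℚ n) ⟩
  mkℚᵘ (+ 1) m ℚᵘ.* mkℚᵘ (+ n) 0      ≈⟨ *≡* (cancel (+ n)) ⟩
  mkℚᵘ (+ 1) 0                        ∎)
  where
  open ℚᵘP.≃-Reasoning
  cancel : ∀ i → (1ℤ ℤ.* i) ℤ.* 1ℤ ≡ 1ℤ ℤ.* (i ℤ.* 1ℤ)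
  cancel = ℤ-Solver.solve-∀

[m*n]/n≡m : ∀ m n .{{_ : ℕ.NonZero n}} → + (m ℕ.* n) ℚ./ n ≡ ℕ→ℚ m
[m*n]/n≡m m n@(suc k) = ℚP.toℚᵘ-injective (begin
  toℚᵘ (+ (m ℕ.* n) ℚ./ n)  ≈⟨ ℚP.toℚᵘ-fromℚᵘ (mkℚᵘ (+ (m ℕ.* n)) k) ⟩
  mkℚᵘ (+ (m ℕ.* n)) k      ≈⟨ *≡* (≡.trans (ℤP.*-identityʳ _) (ℤP.pos-* m n)) ⟩
  mkℚᵘ (+ m) 0              ≈⟨ toℚᵘ-ℕ→ℚ m ⟨
  toℚᵘ (ℕ→ℚ m)              ∎)
  where open ℚᵘP.≃-Reasoning

dPowNeg-suc : ∀ d (d≢0 : d ≢ 0ℚ) k → dPowNeg d d≢0 (suc k) ℚ.* d ≡ dPowNeg d d≢0 k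
dPowNeg-suc d d≢0 k = begin
  (1/d * q) * d   ≡⟨ ℚP.*-assoc 1/d q d ⟩
  1/d * (q * d)   ≡⟨ ≡.cong (1/d *_) (ℚP.*-comm q d) ⟩
  1/d * (d * q)   ≡⟨ ℚP.*-assoc 1/d d q ⟨
  (1/d * d) * q   ≡⟨ ≡.cong (_* q) (ℚP.*-inverseˡ d) ⟩
  1ℚ * q          ≡⟨ ℚP.*-identityˡ q ⟩
  q               ∎
  where
  open ≡.≡-Reasoning
  open import Data.Rational.Base using (_*_)
  instance _ = ℚ.≢-nonZero d≢0
  1/d = ℚ.1/ d
  q = dPowNeg d d≢0 k

q*[m*2]≡2*m*q : ∀ q m → q ℚ.* ℕ→ℚ (m ℕ.* 2) ≡ ℕ→ℚ 2 ℚ.* ℕ→ℚ m ℚ.* q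
q*[m*2]≡2*m*q q m = begin
  q * ℕ→ℚ (m ℕ.* 2)          ≡⟨ ≡.cong (q *_) (ℕ→ℚ-* m 2) ⟩
  q * (ℕ→ℚ m * ℕ→ℚ 2)        ≡⟨ ℚP.*-comm q _ ⟩
  ℕ→ℚ m * ℕ→ℚ 2 * q          ≡⟨ ≡.cong (_* q) (ℚP.*-comm (ℕ→ℚ m) (ℕ→ℚ 2)) ⟩
  ℕ→ℚ 2 * ℕ→ℚ m * q          ∎
  where
  open ≡.≡-Reasoning
  open import Data.Rational.Base using (_*_)

module Inverses {a ℓ} (M : CommutativeMonoid a ℓ) where
  open CommutativeMonoid M
  open CommutativeSemigroupProperties commutativeSemigroup using (interchange; xy∙z≈y∙zx)
  open SetoidReasoning setoid

  cross-multiply : ∀ {u a v b m q} → u ∙ a ≈ ε → v ∙ b ≈ ε → m ∙ b ≈ q ∙ a → u ∙ m ≈ v ∙ q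
  cross-multiply {u} {a} {v} {b} {m} {q} ua≈ε vb≈ε mb≈qa = begin
    u ∙ m              ≈⟨ identityʳ (u ∙ m) ⟨
    (u ∙ m) ∙ ε        ≈⟨ ∙-congˡ vb≈ε ⟨
    (u ∙ m) ∙ (v ∙ b)  ≈⟨ interchange u m v b ⟩
    (u ∙ v) ∙ (m ∙ b)  ≈⟨ ∙-cong (comm u v) mb≈qa ⟩
    (v ∙ u) ∙ (q ∙ a)  ≈⟨ interchange v u q a ⟩
    (v ∙ q) ∙ (u ∙ a)  ≈⟨ ∙-congˡ ua≈ε ⟩
    (v ∙ q) ∙ ε        ≈⟨ identityʳ (v ∙ q) ⟩
    v ∙ q              ∎

  divide : ∀ {w c x y} → w ∙ c ≈ ε → c ∙ x ≈ y → y ∙ w ≈ x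
  divide {w} {c} {x} {y} wc≈ε cx≈y = begin
    y ∙ w        ≈⟨ ∙-congʳ cx≈y ⟨
    (c ∙ x) ∙ w  ≈⟨ xy∙z≈y∙zx c x w ⟩
    x ∙ (w ∙ c)  ≈⟨ ∙-congˡ wc≈ε ⟩
    x ∙ ε        ≈⟨ identityʳ x ⟩
    x            ∎

module _ {c ℓ} (A : QAlgebra c ℓ) where
  open QAlgebra A
  open SetoidReasoning setoid
  open Inverses *-commutativeMonoid
  open CommutativeSemigroupProperties *-commutativeSemigroup using (xy∙z≈xz∙y)
  open CommutativeSemigroupProperties +-commutativeSemigroup
    using () renaming (x∙yz≈xz∙y to x+[y+z]≈[x+z]+y)
  private module ι = IsRingHomomorphism ι-hom

  ι-morphism : ℚP.+-*-rawRing -Raw-AlmostCommutative⟶ fromCommutativeRing R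
  ι-morphism = record
    { ⟦_⟧ = ι ; +-homo = ι.+-homo ; *-homo = ι.*-homo ; -‿homo = ι.-‿homo
    ; 0-homo = ι.0#-homo ; 1-homo = ι.1#-homo }

  _≟ι_ : WeaklyDecidable (λ p q → ι p ≈ ι q)
  p ≟ι q = map (reflexive ∘ ≡.cong ι) (dec⇒maybe (p ℚ.≟ q))

  open import Algebra.Solver.Ring ℚP.+-*-rawRing (fromCommutativeRing R) ι-morphism _≟ι_
    using (Polynomial; solve; _:=_; con; _:+_; _:*_; _:-_; :-_)

  one two : ∀ {n} → Polynomial n
  one = con 1ℚ
  two = con (ℕ→ℚ 2)

  ιℕ : ℕ → Carrier
  ιℕ n = ι (ℕ→ℚ n)

  ιℕ⁻¹ : (n : ℕ) .{{_ : ℕ.NonZero n}} → Carrier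
  ιℕ⁻¹ n = ι (+ 1 ℚ./ n)

  ιℕ-+ : ∀ m n → ιℕ (m ℕ.+ n) ≈ ιℕ m + ιℕ n
  ιℕ-+ m n = trans (reflexive (≡.cong ι (ℕ→ℚ-+ m n))) (ι.+-homo _ _)

  ιℕ-* : ∀ m n → ιℕ (m ℕ.* n) ≈ ιℕ m * ιℕ n
  ιℕ-* m n = trans (reflexive (≡.cong ι (ℕ→ℚ-* m n))) (ι.*-homo _ _)

  ιℕ-suc : ∀ n → ιℕ (suc n) ≈ ι 1ℚ + ιℕ n
  ιℕ-suc = ιℕ-+ 1

  ιℕ⁻¹*ιℕ≈1 : ∀ n .{{_ : ℕ.NonZero n}} → ιℕ⁻¹ n * ιℕ n ≈ 1#
  ιℕ⁻¹*ιℕ≈1 n = trans (sym (ι.*-homo _ _)) (trans (reflexive (≡.cong ι (1/n*n≡1 n))) ι.1#-homo)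

  ι-sub-homo : ∀ p q → ι (p ℚ.- q) ≈ ι p - ι q
  ι-sub-homo p q = trans (ι.+-homo p (ℚ.- q)) (+-congˡ (ι.-‿homo q))

  Σ<-telescope : ∀ (f G : ℕ → Carrier) → (∀ k → f k ≈ G (suc k) - G k) →
                 ∀ n → Σ< A n f ≈ G n - G 0
  Σ<-telescope f G step zero    = sym (-‿inverseʳ (G 0))
  Σ<-telescope f G step (suc n) = begin
    Σ< A n f + f n                   ≈⟨ +-cong (Σ<-telescope f G step n) (step n) ⟩
    (G n - G 0) + (G (suc n) - G n)  ≈⟨ solve 3 (λ a b c → (b :- a) :+ (c :- b) := c :- a) refl
                                                (G 0) (G n) (G (suc n)) ⟩
    G (suc n) - G 0                  ∎

  1/k! : ℕ → Carrier
  1/k! k = ιℕ⁻¹ (k ℕ.!) {{k ℕP.!≢0}}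

  1/k!-step : ∀ k → 1/k! (suc k) * ιℕ (suc k) ≈ 1/k! k
  1/k!-step k = trans (cross-multiply (ιℕ⁻¹*ιℕ≈1 (suc k ℕ.!) {{suc k ℕP.!≢0}})
                                      (ιℕ⁻¹*ιℕ≈1 (k ℕ.!) {{k ℕP.!≢0}})
                                      (trans (sym (ιℕ-* (suc k) (k ℕ.!))) (sym (*-identityˡ _))))
                      (*-identityʳ (1/k! k))

  absorb-1/k! : ∀ k f a → ((f * a) * 1/k! (suc k)) * ιℕ (suc k) ≈ (f * 1/k! k) * a
  absorb-1/k! k f a = begin
    ((f * a) * 1/k! (suc k)) * ιℕ (suc k)   ≈⟨ *-assoc (f * a) _ _ ⟩
    (f * a) * (1/k! (suc k) * ιℕ (suc k))   ≈⟨ *-congˡ (1/k!-step k) ⟩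
    (f * a) * 1/k! k                        ≈⟨ xy∙z≈xz∙y f a (1/k! k) ⟩
    (f * 1/k! k) * a                        ∎

  falling-cong : ∀ {y z} → y ≈ z → ∀ k → falling A y k ≈ falling A z k
  falling-cong y≈z zero    = refl
  falling-cong y≈z (suc k) = *-cong (falling-cong y≈z k) (+-congʳ y≈z)

  binom-cong : ∀ {y z} → y ≈ z → ∀ k → binom A y k ≈ binom A z k
  binom-cong y≈z k = *-congʳ (falling-cong y≈z k)

  falling-shift : ∀ y k → falling A (y + ι 1ℚ) (suc k) ≈ (y + ι 1ℚ) * falling A y k
  falling-shift y zero    = begin
    1# * (y + ι 1ℚ - ι 0ℚ)  ≈⟨ *-identityˡ _ ⟩
    y + ι 1ℚ - ι 0ℚ         ≈⟨ solve 1 (λ y → y :+ one :- con 0ℚ := y :+ one) refl y ⟩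
    y + ι 1ℚ                ≈⟨ *-identityʳ _ ⟨
    (y + ι 1ℚ) * 1#         ∎
  falling-shift y (suc k) = begin
    falling A (y + ι 1ℚ) (suc k) * (y + ι 1ℚ - ιℕ (suc k))
      ≈⟨ *-cong (falling-shift y k) (+-congˡ (-‿cong (ιℕ-suc k))) ⟩
    ((y + ι 1ℚ) * falling A y k) * (y + ι 1ℚ - (ι 1ℚ + ιℕ k))
      ≈⟨ solve 3 (λ y f n → ((y :+ one) :* f) :* (y :+ one :- (one :+ n))
                           := (y :+ one) :* (f :* (y :- n))) refl y (falling A y k) (ιℕ k) ⟩
    (y + ι 1ℚ) * (falling A y k * (y - ιℕ k)) ∎

  binom-suc : ∀ y k → binom A y (suc k) * ιℕ (suc k) ≈ binom A y k * (y - ιℕ k)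
  binom-suc y k = absorb-1/k! k (falling A y k) (y - ιℕ k)

  binom-shift : ∀ y k → binom A (y + ι 1ℚ) (suc k) * ιℕ (suc k) ≈ binom A y k * (y + ι 1ℚ)
  binom-shift y k = begin
    (falling A (y + ι 1ℚ) (suc k) * 1/k! (suc k)) * ιℕ (suc k)
      ≈⟨ *-congʳ (*-congʳ (trans (falling-shift y k) (*-comm _ _))) ⟩
    ((falling A y k * (y + ι 1ℚ)) * 1/k! (suc k)) * ιℕ (suc k)
      ≈⟨ absorb-1/k! k (falling A y k) (y + ι 1ℚ) ⟩
    binom A y k * (y + ι 1ℚ) ∎

  invCentralBinom-step : ∀ k → ι (invCentralBinom (suc k)) * ιℕ (2 ℕ.* suc (2 ℕ.* k))
                               ≈ ι (invCentralBinom k) * ιℕ (suc k)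
  invCentralBinom-step k = cross-multiply
    (ιℕ⁻¹*ιℕ≈1 ((2 ℕ.* suc k) C suc k) {{centralBinom-nonZero (suc k)}})
    (ιℕ⁻¹*ιℕ≈1 ((2 ℕ.* k) C k) {{centralBinom-nonZero k}})
    (begin
      ιℕ (2 ℕ.* suc (2 ℕ.* k)) * ιℕ ((2 ℕ.* k) C k)  ≈⟨ ιℕ-* (2 ℕ.* suc (2 ℕ.* k)) ((2 ℕ.* k) C k) ⟨
      ιℕ (2 ℕ.* suc (2 ℕ.* k) ℕ.* ((2 ℕ.* k) C k))   ≈⟨ reflexive (≡.cong ιℕ ([k+1]*[2k+2]C[k+1]≡2[2k+1]*[2k]Ck k)) ⟨
      ιℕ (suc k ℕ.* ((2 ℕ.* suc k) C suc k))          ≈⟨ ιℕ-* (suc k) ((2 ℕ.* suc k) C suc k) ⟩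
      ιℕ (suc k) * ιℕ ((2 ℕ.* suc k) C suc k)         ∎)

  module Telescoping (d : ℚ) (d≢0 : d ≢ 0ℚ) (x : Carrier) where

    D : Carrier
    D = ι d

    term : ℕ → Carrier
    term k = core A d d≢0 x k * ι (invCentralBinom k)

    numerator : ℕ → Carrier
    numerator k = (x - ιℕ k) * ((x + ιℕ k) + ι 1ℚ)

    term-zero : term 0 ≈ ι 1ℚ
    term-zero = begin
      ((ι 1ℚ * (1# * ι 1ℚ)) * (1# * ι 1ℚ)) * ι 1ℚ
        ≈⟨ *-congʳ (*-cong (*-congˡ (*-congʳ 1≈ι1)) (*-congʳ 1≈ι1)) ⟩
      ((ι 1ℚ * (ι 1ℚ * ι 1ℚ)) * (ι 1ℚ * ι 1ℚ)) * ι 1ℚ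
        ≈⟨ solve 0 (((one :* (one :* one)) :* (one :* one)) :* one := one) refl ⟩
      ι 1ℚ ∎
      where 1≈ι1 = sym ι.1#-homo

    dPowNeg-step : ∀ k → ι (dPowNeg d d≢0 (suc k)) * D ≈ ι (dPowNeg d d≢0 k)
    dPowNeg-step k = trans (sym (ι.*-homo _ _)) (reflexive (≡.cong ι (dPowNeg-suc d d≢0 k)))

    -- 2(2k+1) turns 1/C(2k+2,k+1) into (k+1)/C(2k,k), d cancels one factor 1/d, and the
    -- two factors k+1 lower the indices of both binomial coefficients.
    term-suc : ∀ k → ιℕ 2 * D * (ι 1ℚ + ιℕ k) * (ι 1ℚ + ιℕ 2 * ιℕ k) * term (suc k)
                     ≈ numerator k * term k
    term-suc k = begin
      ιℕ 2 * D * (ι 1ℚ + K) * (ι 1ℚ + ιℕ 2 * K) * (((P′ * bx′) * by′) * iv′)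
        ≈⟨ solve 6 (λ D K P bx by iv →
             two :* D :* (one :+ K) :* (one :+ two :* K) :* (((P :* bx) :* by) :* iv)
             := (((P :* D) :* bx) :* by) :* (iv :* (two :* (one :+ two :* K))) :* (one :+ K))
             refl D K P′ bx′ by′ iv′ ⟩
      (((P′ * D) * bx′) * by′) * (iv′ * (ιℕ 2 * (ι 1ℚ + ιℕ 2 * K))) * (ι 1ℚ + K)
        ≈⟨ *-cong (*-cong (*-congʳ (*-congʳ (dPowNeg-step k))) (*-congˡ (sym twice-odd)))
                  (sym (ιℕ-suc k)) ⟩
      ((P * bx′) * by′) * (iv′ * ιℕ (2 ℕ.* suc (2 ℕ.* k))) * N₁
        ≈⟨ *-congʳ (*-congˡ (invCentralBinom-step k)) ⟩
      ((P * bx′) * by′) * (iv * N₁) * N₁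
        ≈⟨ solve 5 (λ P bx by iv N → ((P :* bx) :* by) :* (iv :* N) :* N
                                    := ((P :* (bx :* N)) :* (by :* N)) :* iv)
                   refl P bx′ by′ iv N₁ ⟩
      ((P * (bx′ * N₁)) * (by′ * N₁)) * iv
        ≈⟨ *-congʳ (*-cong (*-congˡ (binom-suc x k)) by-step) ⟩
      ((P * (bx * (x - K))) * (by * ((x + K) + ι 1ℚ))) * iv
        ≈⟨ solve 7 (λ P bx by iv x K e → ((P :* (bx :* (x :- K))) :* (by :* e)) :* iv
                                         := ((x :- K) :* e) :* (((P :* bx) :* by) :* iv))
                   refl P bx by iv x K ((x + K) + ι 1ℚ) ⟩
      numerator k * term k ∎
      where
      K = ιℕ k
      N₁ = ιℕ (suc k)
      P′ = ι (dPowNeg d d≢0 (suc k))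
      P = ι (dPowNeg d d≢0 k)
      bx′ = binom A x (suc k)
      bx = binom A x k
      by′ = binom A (x + N₁) (suc k)
      by = binom A (x + K) k
      iv′ = ι (invCentralBinom (suc k))
      iv = ι (invCentralBinom k)
      twice-odd : ιℕ (2 ℕ.* suc (2 ℕ.* k)) ≈ ιℕ 2 * (ι 1ℚ + ιℕ 2 * K)
      twice-odd = trans (ιℕ-* 2 (suc (2 ℕ.* k))) (*-congˡ (trans (ιℕ-suc (2 ℕ.* k)) (+-congˡ (ιℕ-* 2 k))))
      by-step : by′ * N₁ ≈ by * ((x + K) + ι 1ℚ)
      by-step = trans (*-congʳ (binom-cong x+N₁≈x+K+1 (suc k))) (binom-shift (x + K) k)
        where
        x+N₁≈x+K+1 : x + N₁ ≈ (x + K) + ι 1ℚ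
        x+N₁≈x+K+1 = trans (+-congˡ (ιℕ-suc k)) (x+[y+z]≈[x+z]+y x (ι 1ℚ) K)

    ι-[1+4d]k² : ∀ k → ι ((1ℚ ℚ.+ ℕ→ℚ 4 ℚ.* d) ℚ.* ℕ→ℚ k ℚ.* ℕ→ℚ k)
                       ≈ (ι 1ℚ + ιℕ 4 * D) * ιℕ k * ιℕ k
    ι-[1+4d]k² k = trans (ι.*-homo _ _) (*-congʳ (trans (ι.*-homo _ _)
                     (*-congʳ (trans (ι.+-homo _ _) (+-congˡ (ι.*-homo _ _))))))

    ι-[1+2d]k : ∀ k → ι ((1ℚ ℚ.+ ℕ→ℚ 2 ℚ.* d) ℚ.* ℕ→ℚ k) ≈ (ι 1ℚ + ιℕ 2 * D) * ιℕ k
    ι-[1+2d]k k = trans (ι.*-homo _ _) (*-congʳ (trans (ι.+-homo _ _) (+-congˡ (ι.*-homo _ _))))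

    ι-[1-2d]k : ∀ k → ι ((1ℚ ℚ.- ℕ→ℚ 2 ℚ.* d) ℚ.* ℕ→ℚ k) ≈ (ι 1ℚ - ιℕ 2 * D) * ιℕ k
    ι-[1-2d]k k = trans (ι.*-homo _ _) (*-congʳ (trans (ι-sub-homo _ _) (+-congˡ (-‿cong (ι.*-homo _ _)))))

    gA gB gC : Carrier → Carrier
    gA n = ιℕ 2 * D * n * (ιℕ 2 * n - ι 1ℚ)
    gB n = ιℕ 2 * D * (ιℕ 2 * n - ι 1ℚ)
    gC n = ιℕ 2 * D * n

    GA GB GC : ℕ → Carrier
    GA k = gA (ιℕ k) * term k
    GB k = gB (ιℕ k) * term k
    GC k = gC (ιℕ k) * term k

    polyA-factor : ∀ k → polyA A d x k ≈ numerator k - ι 1ℚ * gA (ιℕ k)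
    polyA-factor k = trans (+-cong (+-congˡ (-‿cong (ι-[1+4d]k² k))) (-‿cong (ι-[1-2d]k k)))
      (solve 3 (λ x K D → x :* x :+ x :- (one :+ con (ℕ→ℚ 4) :* D) :* K :* K
                                      :- (one :- two :* D) :* K
                          := (x :- K) :* ((x :+ K) :+ one)
                             :- one :* (two :* D :* K :* (two :* K :- one)))
             refl x (ιℕ k) D)

    polyB-factor : ∀ k → polyB A d x k ≈ numerator k - (ι 1ℚ + ιℕ k) * gB (ιℕ k)
    polyB-factor k = trans (+-cong (+-cong (+-congˡ (ι.*-homo _ _)) (-‿cong (ι-[1+4d]k² k)))
                                   (-‿cong (ι-[1+2d]k k)))
      (solve 3 (λ x K D → x :* x :+ x :+ two :* D :- (one :+ con (ℕ→ℚ 4) :* D) :* K :* K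
                                      :- (one :+ two :* D) :* K
                          := (x :- K) :* ((x :+ K) :+ one)
                             :- (one :+ K) :* (two :* D :* (two :* K :- one)))
             refl x (ιℕ k) D)

    polyC-factor : ∀ k → polyC A d x k ≈ numerator k - (ι 1ℚ + ιℕ 2 * ιℕ k) * gC (ιℕ k)
    polyC-factor k = trans (+-cong (+-congˡ (-‿cong (ι-[1+4d]k² k))) (-‿cong (ι-[1+2d]k k)))
      (solve 3 (λ x K D → x :* x :+ x :- (one :+ con (ℕ→ℚ 4) :* D) :* K :* K
                                      :- (one :+ two :* D) :* K
                          := (x :- K) :* ((x :+ K) :+ one)
                             :- (one :+ two :* K) :* (two :* D :* K))
             refl x (ιℕ k) D)

    -- c is the extra denominator of the summand: 1, k+1 or 2k+1.
    telescoping-step : ∀ (g : Carrier → Carrier) → (∀ {m n} → m ≈ n → g m ≈ g n) →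
      ∀ c k → c * g (ι 1ℚ + ιℕ k) ≈ ιℕ 2 * D * (ι 1ℚ + ιℕ k) * (ι 1ℚ + ιℕ 2 * ιℕ k) →
      (numerator k - c * g (ιℕ k)) * term k
        ≈ c * (g (ιℕ (suc k)) * term (suc k) - g (ιℕ k) * term k)
    telescoping-step g g-cong c k c*g[k+1]≈ = begin
      (numerator k - c * g K) * term k
        ≈⟨ solve 4 (λ n c b t → (n :- c :* b) :* t := n :* t :- (c :* b) :* t)
                   refl (numerator k) c (g K) (term k) ⟩
      numerator k * term k - (c * g K) * term k
        ≈⟨ +-congʳ (trans (*-congʳ c*g[k+1]≈) (term-suc k)) ⟨
      (c * g (ι 1ℚ + K)) * term (suc k) - (c * g K) * term k
        ≈⟨ solve 5 (λ c a t′ b t → (c :* a) :* t′ :- (c :* b) :* t := c :* (a :* t′ :- b :* t))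
                   refl c (g (ι 1ℚ + K)) (term (suc k)) (g K) (term k) ⟩
      c * (g (ι 1ℚ + K) * term (suc k) - g K * term k)
        ≈⟨ *-congˡ (+-congʳ (*-congʳ (g-cong (ιℕ-suc k)))) ⟨
      c * (g (ιℕ (suc k)) * term (suc k) - g K * term k) ∎
      where K = ιℕ k

    stepA : ∀ k → polyA A d x k * term k ≈ GA (suc k) - GA k
    stepA k = begin
      polyA A d x k * term k                ≈⟨ *-congʳ (polyA-factor k) ⟩
      (numerator k - ι 1ℚ * gA K) * term k  ≈⟨ telescoping-step gA gA-cong (ι 1ℚ) k coefficient ⟩
      ι 1ℚ * (GA (suc k) - GA k)            ≈⟨ solve 1 (λ z → one :* z := z) refl _ ⟩
      GA (suc k) - GA k                     ∎
      where
      K = ιℕ k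
      gA-cong : ∀ {m n} → m ≈ n → gA m ≈ gA n
      gA-cong m≈n = *-cong (*-congˡ m≈n) (+-congʳ (*-congˡ m≈n))
      coefficient : ι 1ℚ * gA (ι 1ℚ + K) ≈ ιℕ 2 * D * (ι 1ℚ + K) * (ι 1ℚ + ιℕ 2 * K)
      coefficient = solve 2 (λ D K → one :* (two :* D :* (one :+ K) :* (two :* (one :+ K) :- one))
                                     := two :* D :* (one :+ K) :* (one :+ two :* K)) refl D K

    weighted-summand : ∀ p k n .{{_ : ℕ.NonZero n}} →
      p * (core A d d≢0 x k * ι (invCentralBinom k ℚ.* (+ 1 ℚ./ n))) ≈ (p * term k) * ιℕ⁻¹ n
    weighted-summand p k n = begin
      p * (core A d d≢0 x k * ι (invCentralBinom k ℚ.* (+ 1 ℚ./ n)))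
        ≈⟨ *-congˡ (*-congˡ (ι.*-homo _ _)) ⟩
      p * (core A d d≢0 x k * (ι (invCentralBinom k) * ιℕ⁻¹ n))
        ≈⟨ *-congˡ (*-assoc _ _ _) ⟨
      p * (term k * ιℕ⁻¹ n)
        ≈⟨ *-assoc p (term k) (ιℕ⁻¹ n) ⟨
      (p * term k) * ιℕ⁻¹ n ∎

    stepB : ∀ k → polyB A d x k * (core A d d≢0 x k * ι (invCentralBinom k ℚ.* (+ 1 ℚ./ suc k)))
                  ≈ GB (suc k) - GB k
    stepB k = trans (weighted-summand (polyB A d x k) k (suc k)) (divide inverse telescoped)
      where
      K = ιℕ k
      inverse : ιℕ⁻¹ (suc k) * (ι 1ℚ + K) ≈ 1#
      inverse = trans (*-congˡ (sym (ιℕ-suc k))) (ιℕ⁻¹*ιℕ≈1 (suc k))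
      coefficient : (ι 1ℚ + K) * gB (ι 1ℚ + K) ≈ ιℕ 2 * D * (ι 1ℚ + K) * (ι 1ℚ + ιℕ 2 * K)
      coefficient = solve 2 (λ D K → (one :+ K) :* (two :* D :* (two :* (one :+ K) :- one))
                                     := two :* D :* (one :+ K) :* (one :+ two :* K)) refl D K
      telescoped : (ι 1ℚ + K) * (GB (suc k) - GB k) ≈ polyB A d x k * term k
      telescoped = sym (trans (*-congʳ (polyB-factor k))
                              (telescoping-step gB (*-congˡ ∘ +-congʳ ∘ *-congˡ) _ k coefficient))

    stepC : ∀ k → polyC A d x k * (core A d d≢0 x k * ι (invCentralBinom k ℚ.* (+ 1 ℚ./ suc (2 ℕ.* k))))
                  ≈ GC (suc k) - GC k
    stepC k = trans (weighted-summand (polyC A d x k) k (suc (2 ℕ.* k))) (divide inverse telescoped)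
      where
      K = ιℕ k
      inverse : ιℕ⁻¹ (suc (2 ℕ.* k)) * (ι 1ℚ + ιℕ 2 * K) ≈ 1#
      inverse = trans (*-congˡ (sym (trans (ιℕ-suc (2 ℕ.* k)) (+-congˡ (ιℕ-* 2 k)))))
                      (ιℕ⁻¹*ιℕ≈1 (suc (2 ℕ.* k)))
      coefficient : (ι 1ℚ + ιℕ 2 * K) * gC (ι 1ℚ + K) ≈ ιℕ 2 * D * (ι 1ℚ + K) * (ι 1ℚ + ιℕ 2 * K)
      coefficient = solve 2 (λ D K → (one :+ two :* K) :* (two :* D :* (one :+ K))
                                     := two :* D :* (one :+ K) :* (one :+ two :* K)) refl D K
      telescoped : (ι 1ℚ + ιℕ 2 * K) * (GC (suc k) - GC k) ≈ polyC A d x k * term k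
      telescoped = sym (trans (*-congʳ (polyC-factor k)) (telescoping-step gC *-congˡ _ k coefficient))

    SumA-closed : ∀ n → SumA A d d≢0 x n ≈ GA n
    SumA-closed n = trans (Σ<-telescope _ GA stepA n)
      (solve 3 (λ g D t → g :- two :* D :* con 0ℚ :* (two :* con 0ℚ :- one) :* t := g)
             refl (GA n) D (term 0))

    SumB-closed : ∀ n → SumB A d d≢0 x n ≈ GB n + ιℕ 2 * D
    SumB-closed n = trans (Σ<-telescope _ GB stepB n) (trans (+-congˡ (-‿cong (*-congˡ term-zero)))
      (solve 2 (λ g D → g :- two :* D :* (two :* con 0ℚ :- one) :* one := g :+ two :* D)
             refl (GB n) D))

    SumC-closed : ∀ n → SumC A d d≢0 x n ≈ GC n
    SumC-closed n = trans (Σ<-telescope _ GC stepC n)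
      (solve 3 (λ g D t → g :- two :* D :* con 0ℚ :* t := g) refl (GC n) D (term 0))

    ι-[-2nd] : ∀ n → ι (ℚ.- (ℕ→ℚ 2 ℚ.* ℕ→ℚ n ℚ.* d)) ≈ - (ιℕ 2 * ιℕ n * D)
    ι-[-2nd] n = trans (ι.-‿homo _) (-‿cong (trans (ι.*-homo _ _) (*-congʳ (ι.*-homo _ _))))

    ι-[2n-1] : ∀ n → ι (ℕ→ℚ 2 ℚ.* ℕ→ℚ n ℚ.- 1ℚ) ≈ ιℕ 2 * ιℕ n - ι 1ℚ
    ι-[2n-1] n = trans (ι-sub-homo _ _) (+-congʳ (ι.*-homo _ _))

    identities-i : ∀ n →
        (SumA A d d≢0 x n
           ≈ ι (ℚ.- (ℕ→ℚ 2 ℚ.* ℕ→ℚ n ℚ.* d)) + ι (ℕ→ℚ n) * SumB A d d≢0 x n)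
      × (ι (ℚ.- (ℕ→ℚ 2 ℚ.* ℕ→ℚ n ℚ.* d)) + ι (ℕ→ℚ n) * SumB A d d≢0 x n
           ≈ ι (ℕ→ℚ 2 ℚ.* ℕ→ℚ n ℚ.- 1ℚ) * SumC A d d≢0 x n)
    identities-i n =
        trans (SumA-closed n) (trans GA≈middle (sym B≈middle))
      , trans B≈middle (trans middle≈GC (sym (*-cong (ι-[2n-1] n) (SumC-closed n))))
      where
      N = ιℕ n
      middle = - (ιℕ 2 * N * D) + N * (GB n + ιℕ 2 * D)
      B≈middle : ι (ℚ.- (ℕ→ℚ 2 ℚ.* ℕ→ℚ n ℚ.* d)) + ι (ℕ→ℚ n) * SumB A d d≢0 x n ≈ middle
      B≈middle = +-cong (ι-[-2nd] n) (*-congˡ (SumB-closed n))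
      GA≈middle : GA n ≈ middle
      GA≈middle = solve 3 (λ D N t →
        two :* D :* N :* (two :* N :- one) :* t
        := :- (two :* N :* D) :+ N :* (two :* D :* (two :* N :- one) :* t :+ two :* D)) refl D N (term n)
      middle≈GC : middle ≈ (ιℕ 2 * N - ι 1ℚ) * GC n
      middle≈GC = solve 3 (λ D N t →
        :- (two :* N :* D) :+ N :* (two :* D :* (two :* N :- one) :* t :+ two :* D)
        := (two :* N :- one) :* (two :* D :* N :* t)) refl D N (term n)

    Identities-ii : ℕ → ℕ → Set ℓ
    Identities-ii n L =
        (SumA A d d≢0 x L
           ≈ ι (ℚ.- (d ℚ.* ℕ→ℚ (suc n))) + ι (+ suc n ℚ./ 2) * SumB A d d≢0 x L)
      × (ι (ℚ.- (d ℚ.* ℕ→ℚ (suc n))) + ι (+ suc n ℚ./ 2) * SumB A d d≢0 x L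
           ≈ ι (ℕ→ℚ n) * SumC A d d≢0 x L)

    identities-ii-odd : ∀ m → Identities-ii (suc (m ℕ.* 2)) (suc m)
    identities-ii-odd m =
        trans A≈B (+-cong (sym d[n+1]≈2Md) (*-congʳ (sym [n+1]/2≈M)))
      , trans (+-cong d[n+1]≈2Md (*-congʳ [n+1]/2≈M)) (trans B≈C (*-congʳ 2M-1≈n))
      where
      A≈B = proj₁ (identities-i (suc m))
      B≈C = proj₂ (identities-i (suc m))
      -- Transporting along this ℕ-equation with `cong` keeps Agda from comparing the two
      -- rationals by unfolding their gcd-normalisation, which exhausts memory.
      n+1≡M*2 : suc (suc (m ℕ.* 2)) ≡ suc m ℕ.* 2
      n+1≡M*2 = ≡.refl
      d[n+1]≈2Md : ι (ℚ.- (d ℚ.* ℕ→ℚ (suc (suc (m ℕ.* 2)))))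
                   ≈ ι (ℚ.- (ℕ→ℚ 2 ℚ.* ℕ→ℚ (suc m) ℚ.* d))
      d[n+1]≈2Md = reflexive (≡.cong (ι ∘ ℚ.-_)
        (≡.trans (≡.cong (λ t → d ℚ.* ℕ→ℚ t) n+1≡M*2) (q*[m*2]≡2*m*q d (suc m))))
      [n+1]/2≈M : ι (+ suc (suc (m ℕ.* 2)) ℚ./ 2) ≈ ιℕ (suc m)
      [n+1]/2≈M = reflexive (≡.cong ι
        (≡.trans (≡.cong (λ t → + t ℚ./ 2) n+1≡M*2) ([m*n]/n≡m (suc m) 2)))
      2M-1≈n : ι (ℕ→ℚ 2 ℚ.* ℕ→ℚ (suc m) ℚ.- 1ℚ) ≈ ιℕ (suc (m ℕ.* 2))
      2M-1≈n = begin
        ι (ℕ→ℚ 2 ℚ.* ℕ→ℚ (suc m) ℚ.- 1ℚ)  ≈⟨ trans (ι-[2n-1] (suc m)) (+-congʳ (*-congˡ (ιℕ-suc m))) ⟩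
        ιℕ 2 * (ι 1ℚ + ιℕ m) - ι 1ℚ       ≈⟨ solve 1 (λ N → two :* (one :+ N) :- one := one :+ N :* two)
                                                    refl (ιℕ m) ⟩
        ι 1ℚ + ιℕ m * ιℕ 2                ≈⟨ trans (ιℕ-suc (m ℕ.* 2)) (+-congˡ (ιℕ-* m 2)) ⟨
        ιℕ (suc (m ℕ.* 2))                ∎

    identities-ii : ∀ n → n % 2 ≡ 1 → Identities-ii n (suc ((n ℕ.∸ 1) / 2))
    identities-ii n odd =
      ≡.subst (λ n → Identities-ii n (suc ((n ℕ.∸ 1) / 2))) (≡.sym (odd⇒≡1+[n/2]*2 n odd))
        (≡.subst (Identities-ii (suc (n / 2 ℕ.* 2)) ∘ suc) (≡.sym (m*n/n≡m (n / 2) 2))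
          (identities-ii-odd (n / 2)))

-- The identities hold in every ℚ-algebra and for every n.
theorem1p5 : ∀ {c ℓ : Level} (p : ℕ) → Prime p → (d : ℚ) → (d≢0 : d ≢ 0ℚ)
    → (A : QAlgebra c ℓ) → (x : QAlgebra.Carrier A)
    → let open QAlgebra A in
      ((n : ℕ) → 1 ≤ n →
          (SumA A d d≢0 x n
             ≈ ι (ℚ.- (ℕ→ℚ 2 ℚ.* ℕ→ℚ n ℚ.* d)) + ι (ℕ→ℚ n) * SumB A d d≢0 x n)
        × (ι (ℚ.- (ℕ→ℚ 2 ℚ.* ℕ→ℚ n ℚ.* d)) + ι (ℕ→ℚ n) * SumB A d d≢0 x n
             ≈ ι (ℕ→ℚ 2 ℚ.* ℕ→ℚ n ℚ.- 1ℚ) * SumC A d d≢0 x n))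
      × ((n : ℕ) → n % 2 ≡ 1 →
          (SumA A d d≢0 x (suc ((n ℕ.∸ 1) / 2))
             ≈ ι (ℚ.- (d ℚ.* ℕ→ℚ (suc n)))
               + ι (+ suc n ℚ./ 2) * SumB A d d≢0 x (suc ((n ℕ.∸ 1) / 2)))
        × (ι (ℚ.- (d ℚ.* ℕ→ℚ (suc n)))
               + ι (+ suc n ℚ./ 2) * SumB A d d≢0 x (suc ((n ℕ.∸ 1) / 2))
             ≈ ι (ℕ→ℚ n) * SumC A d d≢0 x (suc ((n ℕ.∸ 1) / 2))))
theorem1p5 _ _ d d≢0 A x = (λ n _ → identities-i n) , identities-ii
  where open Telescoping A d d≢0 x
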